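{- Let $h$ be a Hessenberg function with degree tuple $\beta$. The generating set $\mathcal{J}_h=\{\tilde e_{\beta_n}(n),\tilde e_{\beta_{n-1}}(n-1,n),\ldots,\tilde e_{\beta_1}(1,\ldots,n)\}$ is a Gröbner basis for the ideal $J_h$ of $\mathbb{Z}[x_1,\ldots,x_n]$ with respect to the lexicographic or the graded lexicographic monomial order.
   Context: A Hessenberg function is an $n$-tuple $h=(h_1,\ldots,h_n)$ of integers with $i\le h_i\le n$ and $h_i\le h_{i+1}$. Its degree tuple is $\beta=(\beta_n,\ldots,\beta_1)$ with $\beta_i=i-\#\{k:h_k<i\}$. For $S\subseteq\{1,\ldots,n\}$, $\tilde e_d(S)$ is the sum of all monomials (not necessarily squarefree) of degree $d$ in the variables $x_i$, $i\in S$, and $\tilde e_d(i,\ldots,n)$ means $S=\{i,\ldots,n\}$. $J_h$ is the ideal generated by $\mathcal{J}_h$. Lexicographic order: $x^\alpha>x^\gamma$ if the leftmost nonzero entry of $\alpha-\gamma$ is positive (so $x_1>x_2>\cdots>x_n$); graded lex compares total degree first and then lex. A set $G=\{g_1,\ldots,g_t\}$ is a Gröbner basis of an ideal $I$ if the ideal generated by leading terms of all elements of $I$ equals $\langle LT(g_1),\ldots,LT(g_t)\rangle$. -}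

module Defs where

open import Data.Nat as ℕ using (ℕ; zero; suc; _≤_; _<_; _∸_)
open import Data.Integer as ℤ using (ℤ; 0ℤ; 1ℤ)
open import Data.Vec as Vec using (Vec; []; _∷_; zipWith)
open import Data.Vec.Properties using (≡-dec)
open import Data.List as List using (List; []; _∷_; _++_; map; concatMap; filter; length; upTo)
open import Data.List.Relation.Unary.All using (All)
open import Data.List.Membership.Propositional using (_∈_)
open import Data.Product using (Σ; ∃; _×_; _,_; proj₁; proj₂)
open import Data.Sum using (_⊎_)
open import Relation.Binary.PropositionalEquality using (_≡_; _≢_)
open import Relation.Nullary using (yes; no; ¬_)
open import Relation.Nullary.Decidable using (⌊_⌋)
open import Data.Bool using (Bool; true; false; _∧_)
open import Function.Bundles using (_⇔_)

-- Monomials in x₁,…,xₙ : exponent vectors; position 0 is x₁.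

Mon : ℕ → Set
Mon n = Vec ℕ n

deg : ∀ {n} → Mon n → ℕ
deg [] = 0
deg (a ∷ as) = a ℕ.+ deg as

-- Polynomials over ℤ: finite lists of terms (coefficient, monomial),
-- compared semantically via their coefficient functions.

Poly : ℕ → Set
Poly n = List (ℤ × Mon n)

coeff : ∀ {n} → Poly n → Mon n → ℤ
coeff [] m = 0ℤ
coeff ((c , a) ∷ p) m with ≡-dec ℕ._≟_ a m
... | yes _ = c ℤ.+ coeff p m
... | no  _ = coeff p m

_≈P_ : ∀ {n} → Poly n → Poly n → Set
p ≈P q = ∀ m → coeff p m ≡ coeff q m

_+P_ : ∀ {n} → Poly n → Poly n → Poly n
p +P q = p ++ q

_*P_ : ∀ {n} → Poly n → Poly n → Poly n
p *P q = concatMap (λ { (c , a) → map (λ { (d , b) → (c ℤ.* d , zipWith ℕ._+_ a b) }) q }) p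

0P : ∀ {n} → Poly n
0P = []

combo : ∀ {n} → List (Poly n × Poly n) → Poly n
combo [] = 0P
combo ((q , g) ∷ qs) = (q *P g) +P combo qs

InIdeal : ∀ {n} → (Poly n → Set) → Poly n → Set
InIdeal {n} S f =
  Σ (List (Poly n × Poly n)) λ qs → All (λ qg → S (proj₂ qg)) qs × (f ≈P combo qs)

_<lex_ : ∀ {n} → Mon n → Mon n → Set
[] <lex [] = Data.Empty.⊥ where import Data.Empty
(a ∷ as) <lex (b ∷ bs) = (a < b) ⊎ ((a ≡ b) × (as <lex bs))

data MonOrder : Set where
  lex grlex : MonOrder

_<[_]_ : ∀ {n} → Mon n → MonOrder → Mon n → Set
a <[ lex ] b = a <lex b
a <[ grlex ] b = (deg a < deg b) ⊎ ((deg a ≡ deg b) × (a <lex b))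

_≤[_]_ : ∀ {n} → Mon n → MonOrder → Mon n → Set
a ≤[ o ] b = (a <[ o ] b) ⊎ (a ≡ b)

IsLT : ∀ {n} → MonOrder → Poly n → Poly n → Set
IsLT {n} o f t =
  Σ ℤ λ c → Σ (Mon n) λ m →
    (c ≢ 0ℤ) × (coeff f m ≡ c) ×
    (∀ m' → coeff f m' ≢ 0ℤ → m' ≤[ o ] m) ×
    (t ≡ (c , m) ∷ [])

LTs : ∀ {n} → MonOrder → (Poly n → Set) → Poly n → Set
LTs o S t = Σ _ λ f → S f × IsLT o f t

IsGroebnerBasisOf : ∀ {n} → MonOrder → List (Poly n) → (Poly n → Set) → Set
IsGroebnerBasisOf o G I =
  ∀ p → InIdeal (LTs o I) p ⇔ InIdeal (LTs o (_∈ G)) p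

-- Hessenberg functions, 1-based: h : ℕ → ℕ, only values h 1 … h n matter.

record IsHessenberg (n : ℕ) (h : ℕ → ℕ) : Set where
  field
    bounds : ∀ i → 1 ≤ i → i ≤ n → (i ≤ h i) × (h i ≤ n)
    mono   : ∀ i → 1 ≤ i → i < n → h i ≤ h (suc i)

oneTo : ℕ → List ℕ
oneTo n = map suc (upTo n)

-- β_i = i − #{k ∈ {1,…,n} : h_k < i}   (the subtraction is exact since h_k ≥ k)
β : ℕ → (ℕ → ℕ) → ℕ → ℕ
β n h i = i ∸ length (filter (λ k → h k ℕ.<? i) (oneTo n))

homMons : (n d : ℕ) → List (Mon n)
homMons zero zero = [] ∷ []
homMons zero (suc d) = []
homMons (suc n) d = concatMap (λ a → map (a ∷_) (homMons n (d ∸ a))) (upTo (suc d))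

zeroPrefix : ∀ {n} → ℕ → Mon n → Bool
zeroPrefix zero a = true
zeroPrefix (suc k) [] = true
zeroPrefix (suc k) (a ∷ as) = ⌊ a ℕ.≟ 0 ⌋ ∧ zeroPrefix k as

-- ẽ_d(i,…,n): sum of all monomials of degree d in x_i,…,x_n  (i ≥ 1)
ẽ : (n d i : ℕ) → Poly n
ẽ n d i = map (λ a → (1ℤ , a)) (filter (λ a → zeroPrefix (i ∸ 1) a Data.Bool.≟ true) (homMons n d))
  where import Data.Bool

𝒥 : (n : ℕ) → (ℕ → ℕ) → List (Poly n)
𝒥 n h = map (λ i → ẽ n (β n h i) i) (oneTo n)

J : (n : ℕ) → (ℕ → ℕ) → Poly n → Set
J n h = InIdeal (_∈ 𝒥 n h)

module Submission where

-- For lex and grlex the leading term of ẽ_d(k,…,n) is x_k^d, so it suffices that the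
-- leading monomial m of every nonzero f ∈ J is divisible by some x_k^{β_k}.  Otherwise m is
-- standard (m_k < β_k for all k), and one builds, one variable at a time, a ℤ-valued
-- function φ on monomials that annihilates every monomial multiple of every generator and
-- is 1 at m and 0 at all smaller monomials.  Extended linearly, φ vanishes on J, yet on f
-- it picks out the nonzero leading coefficient.

open import Defs
open import Data.Nat as ℕ using (ℕ; zero; suc; _≤_; _<_; _∸_; z≤n; s≤s; _<ᵇ_; _≡ᵇ_)
import Data.Nat.Properties as ℕP
open import Data.Integer as ℤ using (ℤ; 0ℤ; 1ℤ; _+_; _*_; -_)
import Data.Integer.Properties as ℤP
open import Data.Vec using ([]; _∷_; zipWith; replicate)
open import Data.Vec.Properties
  using (≡-dec; ∷-injectiveˡ; ∷-injectiveʳ; zipWith-assoc; zipWith-comm; zipWith-identityˡ; zipWith-identityʳ)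
open import Data.List
  using (List; []; _∷_; _++_; [_]; map; concatMap; filter; applyUpTo; upTo; deduplicate)
open import Data.List.Properties using (filter-++; ++-identityʳ; upTo-∷ʳ)
open import Data.List.Relation.Unary.All as All using (All; []; _∷_)
import Data.List.Relation.Unary.All.Properties as AllP
open import Data.List.Relation.Unary.Any using (here; there)
open import Data.List.Relation.Unary.Unique.Propositional using (Unique)
open import Data.List.Relation.Unary.Unique.DecPropositional.Properties using (deduplicate-!)
open import Data.List.Relation.Unary.AllPairs using ([]; _∷_)
open import Data.List.Membership.Propositional using (_∈_)
open import Data.List.Membership.Propositional.Properties
  using (∈-map⁻; ∈-map⁺; ∈-upTo⁻; ∈-upTo⁺; ∈-filter⁻; ∈-deduplicate⁺)
open import Data.Product using (Σ; _×_; _,_; proj₁; proj₂)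
open import Data.Sum using (_⊎_; inj₁; inj₂)
open import Data.Bool as Bool using (true; false; if_then_else_; T)
open import Data.Empty using (⊥-elim)
open import Relation.Nullary using (Dec; does; yes; no; ¬_)
open import Relation.Binary.PropositionalEquality hiding (J; [_])
open import Relation.Binary.Definitions using (tri<; tri≈; tri>)
open import Function using (_∘_)
open import Function.Bundles using (mk⇔)

module _ {A : Set} where

  ∑ : List A → (A → ℤ) → ℤ
  ∑ [] f = 0ℤ
  ∑ (x ∷ xs) f = f x + ∑ xs f

  ∑-cong : ∀ xs {f g : A → ℤ} → (∀ {x} → x ∈ xs → f x ≡ g x) → ∑ xs f ≡ ∑ xs g
  ∑-cong [] e = refl
  ∑-cong (x ∷ xs) e = cong₂ _+_ (e (here refl)) (∑-cong xs (e ∘ there))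

  ∑-zero : ∀ xs {f : A → ℤ} → (∀ {x} → x ∈ xs → f x ≡ 0ℤ) → ∑ xs f ≡ 0ℤ
  ∑-zero [] e = refl
  ∑-zero (x ∷ xs) e rewrite e (here refl) | ∑-zero xs (e ∘ there) = refl

  ∑-++ : ∀ xs ys (f : A → ℤ) → ∑ (xs ++ ys) f ≡ ∑ xs f + ∑ ys f
  ∑-++ [] ys f = sym (ℤP.+-identityˡ _)
  ∑-++ (x ∷ xs) ys f rewrite ∑-++ xs ys f = sym (ℤP.+-assoc (f x) _ _)

  ∑-+ : ∀ xs (f g : A → ℤ) → ∑ xs (λ x → f x + g x) ≡ ∑ xs f + ∑ xs g
  ∑-+ [] f g = refl
  ∑-+ (x ∷ xs) f g rewrite ∑-+ xs f g = interchange (f x) (g x) (∑ xs f) (∑ xs g)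
    where open import Algebra.Properties.CommutativeSemigroup ℤP.+-commutativeSemigroup using (interchange)

  ∑-neg : ∀ xs (f : A → ℤ) → ∑ xs (λ x → - f x) ≡ - ∑ xs f
  ∑-neg [] f = refl
  ∑-neg (x ∷ xs) f rewrite ∑-neg xs f = sym (ℤP.neg-distrib-+ (f x) (∑ xs f))

module _ {A B : Set} where

  ∑-map : ∀ (g : A → B) xs (f : B → ℤ) → ∑ (map g xs) f ≡ ∑ xs (f ∘ g)
  ∑-map g [] f = refl
  ∑-map g (x ∷ xs) f = cong (f (g x) +_) (∑-map g xs f)

  ∑-concatMap : ∀ (g : A → List B) xs (f : B → ℤ) →
    ∑ (concatMap g xs) f ≡ ∑ xs (λ x → ∑ (g x) f)
  ∑-concatMap g [] f = refl
  ∑-concatMap g (x ∷ xs) f =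
    trans (∑-++ (g x) (concatMap g xs) f) (cong (∑ (g x) f +_) (∑-concatMap g xs f))

  ∑-swap : ∀ xs ys (f : A → B → ℤ) →
    ∑ xs (λ x → ∑ ys (f x)) ≡ ∑ ys (λ y → ∑ xs (λ x → f x y))
  ∑-swap [] ys f = sym (∑-zero ys (λ _ → refl))
  ∑-swap (x ∷ xs) ys f rewrite ∑-swap xs ys f = sym (∑-+ ys (f x) (λ y → ∑ xs (λ x → f x y)))

∑-upTo-suc : ∀ N (f : ℕ → ℤ) → ∑ (upTo (suc N)) f ≡ ∑ (upTo N) f + f N
∑-upTo-suc N f = begin
  ∑ (upTo (suc N)) f          ≡⟨ cong (λ xs → ∑ xs f) (sym (upTo-∷ʳ N)) ⟩
  ∑ (upTo N ++ [ N ]) f       ≡⟨ ∑-++ (upTo N) [ N ] f ⟩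
  ∑ (upTo N) f + (f N + 0ℤ)   ≡⟨ cong (∑ (upTo N) f +_) (ℤP.+-identityʳ (f N)) ⟩
  ∑ (upTo N) f + f N          ∎
  where open ≡-Reasoning

infixl 6 _⊕_
_⊕_ : ∀ {n} → Mon n → Mon n → Mon n
_⊕_ = zipWith ℕ._+_

zeros : ∀ {n} → Mon n
zeros = replicate _ 0

_≟ᵐ_ : ∀ {n} (a b : Mon n) → Dec (a ≡ b)
_≟ᵐ_ = ≡-dec ℕ._≟_

⊕-assoc : ∀ {n} (a b c : Mon n) → (a ⊕ b) ⊕ c ≡ a ⊕ (b ⊕ c)
⊕-assoc = zipWith-assoc ℕP.+-assoc

⊕-comm : ∀ {n} (a b : Mon n) → a ⊕ b ≡ b ⊕ a
⊕-comm = zipWith-comm ℕP.+-comm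

⊕-identityʳ : ∀ {n} (a : Mon n) → a ⊕ zeros ≡ a
⊕-identityʳ = zipWith-identityʳ ℕP.+-identityʳ

⊕-identityˡ : ∀ {n} (a : Mon n) → zeros ⊕ a ≡ a
⊕-identityˡ = zipWith-identityˡ ℕP.+-identityˡ

⊕-swapʳ : ∀ {n} (a b c : Mon n) → (a ⊕ b) ⊕ c ≡ (a ⊕ c) ⊕ b
⊕-swapʳ a b c = trans (⊕-assoc a b c) (trans (cong (a ⊕_) (⊕-comm b c)) (sym (⊕-assoc a c b)))

deg-⊕ : ∀ {n} (a b : Mon n) → deg (a ⊕ b) ≡ deg a ℕ.+ deg b
deg-⊕ [] [] = refl
deg-⊕ (x ∷ a) (y ∷ b) rewrite deg-⊕ a b = interchange x y (deg a) (deg b)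
  where open import Algebra.Properties.CommutativeSemigroup ℕP.+-commutativeSemigroup using (interchange)

deg-zeros : ∀ n → deg (zeros {n}) ≡ 0
deg-zeros zero = refl
deg-zeros (suc n) = deg-zeros n

deg≡0⇒zeros : ∀ {n} (a : Mon n) → deg a ≡ 0 → a ≡ zeros
deg≡0⇒zeros [] _ = refl
deg≡0⇒zeros (zero ∷ a) e = cong (0 ∷_) (deg≡0⇒zeros a e)

-- Variables are indexed from 0: a ! k is the exponent of x_{k+1} in a,
-- and xPow n k d is x_{k+1}^d.
_!_ : ∀ {n} → Mon n → ℕ → ℕ
[] ! k = 0
(x ∷ a) ! zero = x
(x ∷ a) ! suc k = a ! k

xPow : (n k d : ℕ) → Mon n
xPow zero k d = []
xPow (suc n) zero d = d ∷ zeros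
xPow (suc n) (suc k) d = 0 ∷ xPow n k d

deg-xPow : ∀ n k d → k < n → deg (xPow n k d) ≡ d
deg-xPow (suc n) zero d _ rewrite deg-zeros n = ℕP.+-identityʳ d
deg-xPow (suc n) (suc k) d (s≤s k<n) = deg-xPow n k d k<n

_∸ᵐ_ : ∀ {n} → Mon n → Mon n → Mon n
_∸ᵐ_ = zipWith _∸_

∸ᵐ-zeros : ∀ {n} (a : Mon n) → (a ∸ᵐ zeros) ⊕ zeros ≡ a
∸ᵐ-zeros a = trans (⊕-identityʳ (a ∸ᵐ zeros)) (zipWith-identityʳ (λ _ → refl) a)

∸ᵐ-xPow : ∀ n k d (a : Mon n) → k < n → d ≤ a ! k → (a ∸ᵐ xPow n k d) ⊕ xPow n k d ≡ a
∸ᵐ-xPow (suc n) zero d (x ∷ a) _ d≤x = cong₂ _∷_ (ℕP.m∸n+n≡m d≤x) (∸ᵐ-zeros a)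
∸ᵐ-xPow (suc n) (suc k) d (x ∷ a) (s≤s k<n) d≤a!k =
  cong₂ _∷_ (ℕP.+-identityʳ x) (∸ᵐ-xPow n k d a k<n d≤a!k)

sameDeg-≤lex⇒≤[_] : ∀ {n} o {a b : Mon n} → deg a ≡ deg b → a <lex b ⊎ a ≡ b → a ≤[ o ] b
sameDeg-≤lex⇒≤[ o ] _ (inj₂ a≡b) = inj₂ a≡b
sameDeg-≤lex⇒≤[ lex ] _ (inj₁ a<b) = inj₁ a<b
sameDeg-≤lex⇒≤[ grlex ] e (inj₁ a<b) = inj₁ (inj₂ (e , a<b))

coeffTerm : ∀ {n} → ℤ → Mon n → Mon n → ℤ
coeffTerm c a m = if does (a ≟ᵐ m) then c else 0ℤ

coeff-∷ : ∀ {n} c (a : Mon n) F m → coeff ((c , a) ∷ F) m ≡ coeffTerm c a m + coeff F m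
coeff-∷ c a F m with a ≟ᵐ m
... | yes _ = refl
... | no _ = sym (ℤP.+-identityˡ _)

coeffTerm-≡ : ∀ {n} c (a : Mon n) → coeffTerm c a a ≡ c
coeffTerm-≡ c a with a ≟ᵐ a
... | yes _ = refl
... | no a≢a = ⊥-elim (a≢a refl)

coeffTerm-≢ : ∀ {n} c {a m : Mon n} → a ≢ m → coeffTerm c a m ≡ 0ℤ
coeffTerm-≢ c {a} {m} a≢m with a ≟ᵐ m
... | yes a≡m = ⊥-elim (a≢m a≡m)
... | no _ = refl

coeffTerm-∷ : ∀ {n} c t (a m : Mon n) → coeffTerm c (t ∷ a) (t ∷ m) ≡ coeffTerm c a m
coeffTerm-∷ c t a m = by (a ≟ᵐ m)
  where
  by : Dec (a ≡ m) → coeffTerm c (t ∷ a) (t ∷ m) ≡ coeffTerm c a m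
  by (yes refl) = trans (coeffTerm-≡ c (t ∷ a)) (sym (coeffTerm-≡ c a))
  by (no a≢m) = trans (coeffTerm-≢ c {t ∷ a} {t ∷ m} (a≢m ∘ ∷-injectiveʳ)) (sym (coeffTerm-≢ c a≢m))

coeff≢0⇒∈ : ∀ {n} (F : Poly n) m → coeff F m ≢ 0ℤ → m ∈ map proj₂ F
coeff≢0⇒∈ [] m ≢0 = ⊥-elim (≢0 refl)
coeff≢0⇒∈ ((c , a) ∷ F) m ≢0 with a ≟ᵐ m
... | yes a≡m = here (sym a≡m)
... | no _ = there (coeff≢0⇒∈ F m ≢0)

monomials : ∀ {n} → List (Mon n) → Poly n
monomials = map (λ a → (1ℤ , a))

coeff-monomials : ∀ {n} (L : List (Mon n)) m → coeff (monomials L) m ≡ ∑ L (λ a → coeffTerm 1ℤ a m)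
coeff-monomials [] m = refl
coeff-monomials (a ∷ L) m =
  trans (coeff-∷ 1ℤ a (monomials L) m) (cong (coeffTerm 1ℤ a m +_) (coeff-monomials L m))

support-monomials : ∀ {n} (L : List (Mon n)) → map proj₂ (monomials L) ≡ L
support-monomials [] = refl
support-monomials (a ∷ L) = cong (a ∷_) (support-monomials L)

homMonsFrom : (n k d : ℕ) → List (Mon n)
homMonsFrom n k d = filter (λ a → zeroPrefix k a Bool.≟ true) (homMons n d)

∑-homMons-suc : ∀ n d (f : Mon (suc n) → ℤ) →
  ∑ (homMons (suc n) d) f ≡ ∑ (upTo (suc d)) (λ t → ∑ (homMons n (d ∸ t)) (λ a → f (t ∷ a)))
∑-homMons-suc n d f =
  trans (∑-concatMap (λ t → map (t ∷_) (homMons n (d ∸ t))) (upTo (suc d)) f)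
        (∑-cong (upTo (suc d)) (λ {t} _ → ∑-map (t ∷_) (homMons n (d ∸ t)) f))

homMons-0 : ∀ n → homMons n 0 ≡ [ zeros ]
homMons-0 zero = refl
homMons-0 (suc n) rewrite homMons-0 n = refl

homMons-deg : ∀ n d → All (λ a → deg a ≡ d) (homMons n d)
homMons-deg zero zero = refl ∷ []
homMons-deg zero (suc d) = []
homMons-deg (suc n) d = go (λ i → i) (suc d) (λ i<sd → ℕP.≤-pred i<sd)
  where
  go : ∀ (f : ℕ → ℕ) N → (∀ {i} → i < N → f i ≤ d) →
    All (λ a → deg a ≡ d) (concatMap (λ t → map (t ∷_) (homMons n (d ∸ t))) (applyUpTo f N))
  go f zero _ = []
  go f (suc N) f≤d =
    AllP.++⁺ (AllP.map⁺ (All.map (λ e → trans (cong (f 0 ℕ.+_) e) (ℕP.m+[n∸m]≡n (f≤d (s≤s z≤n))))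
                                  (homMons-deg n (d ∸ f 0))))
             (go (f ∘ suc) N (λ i<N → f≤d (s≤s i<N)))

homMonsFrom-zero : ∀ n d → homMonsFrom n 0 d ≡ homMons n d
homMonsFrom-zero n d = go (homMons n d)
  where
  go : ∀ (xs : List (Mon n)) → filter (λ a → zeroPrefix 0 a Bool.≟ true) xs ≡ xs
  go [] = refl
  go (x ∷ xs) = cong (x ∷_) (go xs)

homMonsFrom-suc : ∀ n k d → homMonsFrom (suc n) (suc k) d ≡ map (0 ∷_) (homMonsFrom n k d)
homMonsFrom-suc n k d = begin
  homMonsFrom (suc n) (suc k) d
    ≡⟨ filter-++ P? (map (0 ∷_) (homMons n d)) (rest (λ i → i) d) ⟩
  filter P? (map (0 ∷_) (homMons n d)) ++ filter P? (rest (λ i → i) d)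
    ≡⟨ cong₂ _++_ (first (homMons n d)) (positive (λ i → i) d) ⟩
  map (0 ∷_) (homMonsFrom n k d) ++ []
    ≡⟨ ++-identityʳ _ ⟩
  map (0 ∷_) (homMonsFrom n k d) ∎
  where
  open ≡-Reasoning
  P? = λ (a : Mon (suc n)) → zeroPrefix (suc k) a Bool.≟ true
  rest : (ℕ → ℕ) → ℕ → List (Mon (suc n))
  rest f N = concatMap (λ t → map (t ∷_) (homMons n (d ∸ t))) (applyUpTo (suc ∘ f) N)
  first : ∀ xs → filter P? (map (0 ∷_) xs) ≡ map (0 ∷_) (filter (λ a → zeroPrefix k a Bool.≟ true) xs)
  first [] = refl
  first (x ∷ xs) with zeroPrefix k x
  ... | true = cong ((0 ∷ x) ∷_) (first xs)
  ... | false = first xs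
  headPositive : ∀ t xs → filter P? (map (suc t ∷_) xs) ≡ []
  headPositive t [] = refl
  headPositive t (x ∷ xs) = headPositive t xs
  positive : ∀ f N → filter P? (rest f N) ≡ []
  positive f zero = refl
  positive f (suc N) =
    trans (filter-++ P? (map (suc (f 0) ∷_) (homMons n (d ∸ suc (f 0)))) (rest (f ∘ suc) N))
          (cong₂ _++_ (headPositive (f 0) (homMons n (d ∸ suc (f 0)))) (positive (f ∘ suc) N))

≤lex-xPow : ∀ n k d (a : Mon n) → k < n → deg a ≡ d → zeroPrefix k a ≡ true →
  a <lex xPow n k d ⊎ a ≡ xPow n k d
≤lex-xPow (suc n) zero d (x ∷ a) _ dg _ with ℕP.<-cmp x d
... | tri< x<d _ _ = inj₁ (inj₁ x<d)
... | tri≈ _ refl _ =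
  inj₂ (cong (x ∷_) (deg≡0⇒zeros a (ℕP.+-cancelˡ-≡ x (deg a) 0 (trans dg (sym (ℕP.+-identityʳ x))))))
... | tri> _ _ x>d = ⊥-elim (ℕP.<⇒≱ x>d (subst (x ℕ.≤_) dg (ℕP.m≤m+n x (deg a))))
≤lex-xPow (suc n) (suc k) d (zero ∷ a) (s≤s k<n) dg zp with ≤lex-xPow n k d a k<n dg zp
... | inj₁ a<u = inj₁ (inj₂ (refl , a<u))
... | inj₂ a≡u = inj₂ (cong (0 ∷_) a≡u)

coeff-ẽ-xPow : ∀ n k d → k < n → coeff (ẽ n d (suc k)) (xPow n k d) ≡ 1ℤ
coeff-ẽ-xPow n k d k<n = trans (coeff-monomials (homMonsFrom n k d) (xPow n k d)) (count n k k<n)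
  where
  count : ∀ n k → k < n → ∑ (homMonsFrom n k d) (λ a → coeffTerm 1ℤ a (xPow n k d)) ≡ 1ℤ
  count (suc n) zero _ = begin
    ∑ (homMonsFrom (suc n) 0 d) F
      ≡⟨ cong (λ xs → ∑ xs F) (homMonsFrom-zero (suc n) d) ⟩
    ∑ (homMons (suc n) d) F
      ≡⟨ ∑-homMons-suc n d F ⟩
    ∑ (upTo (suc d)) G
      ≡⟨ ∑-upTo-suc d G ⟩
    ∑ (upTo d) G + G d
      ≡⟨ cong (_+ G d) (∑-zero (upTo d) (λ {t} t∈ → ∑-zero (homMons n (d ∸ t)) (λ {a} _ → coeffTerm-≢ 1ℤ {t ∷ a}
           (ℕP.<⇒≢ (∈-upTo⁻ t∈) ∘ ∷-injectiveˡ)))) ⟩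
    0ℤ + G d
      ≡⟨ cong (λ e → 0ℤ + ∑ (homMons n e) (λ a → F (d ∷ a))) (ℕP.n∸n≡0 d) ⟩
    0ℤ + ∑ (homMons n 0) (λ a → F (d ∷ a))
      ≡⟨ cong (λ xs → 0ℤ + ∑ xs (λ a → F (d ∷ a))) (homMons-0 n) ⟩
    0ℤ + (F (d ∷ zeros) + 0ℤ)
      ≡⟨ cong (λ z → 0ℤ + (z + 0ℤ)) (coeffTerm-≡ 1ℤ (d ∷ zeros {n})) ⟩
    1ℤ ∎
    where
    open ≡-Reasoning
    F : Mon (suc n) → ℤ
    F a = coeffTerm 1ℤ a (d ∷ zeros)
    G : ℕ → ℤ
    G t = ∑ (homMons n (d ∸ t)) (λ a → F (t ∷ a))
  count (suc n) (suc k) (s≤s k<n) = begin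
    ∑ (homMonsFrom (suc n) (suc k) d) (λ a → coeffTerm 1ℤ a (0 ∷ xPow n k d))
      ≡⟨ cong (λ xs → ∑ xs (λ a → coeffTerm 1ℤ a (0 ∷ xPow n k d))) (homMonsFrom-suc n k d) ⟩
    ∑ (map (0 ∷_) (homMonsFrom n k d)) (λ a → coeffTerm 1ℤ a (0 ∷ xPow n k d))
      ≡⟨ ∑-map (0 ∷_) (homMonsFrom n k d) (λ a → coeffTerm 1ℤ a (0 ∷ xPow n k d)) ⟩
    ∑ (homMonsFrom n k d) (λ a → coeffTerm 1ℤ (0 ∷ a) (0 ∷ xPow n k d))
      ≡⟨ ∑-cong (homMonsFrom n k d) (λ {a} _ → coeffTerm-∷ 1ℤ 0 a (xPow n k d)) ⟩
    ∑ (homMonsFrom n k d) (λ a → coeffTerm 1ℤ a (xPow n k d))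
      ≡⟨ count n k k<n ⟩
    1ℤ ∎
    where open ≡-Reasoning

ẽ-leadingTerm : ∀ n k d o → k < n → IsLT o (ẽ n d (suc k)) [ (1ℤ , xPow n k d) ]
ẽ-leadingTerm n k d o k<n = 1ℤ , xPow n k d , (λ ()) , coeff-ẽ-xPow n k d k<n , maximal , refl
  where
  maximal : ∀ a → coeff (ẽ n d (suc k)) a ≢ 0ℤ → a ≤[ o ] xPow n k d
  maximal a ≢0 with ∈-filter⁻ (λ a → zeroPrefix k a Bool.≟ true) {xs = homMons n d}
    (subst (a ∈_) (support-monomials (homMonsFrom n k d)) (coeff≢0⇒∈ (ẽ n d (suc k)) a ≢0))
  ... | a∈ , zp = sameDeg-≤lex⇒≤[ o ] (trans dg (sym (deg-xPow n k d k<n))) (≤lex-xPow n k d a k<n dg zp)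
    where dg = All.lookup (homMons-deg n d) a∈

Annihilates : ∀ {n} → (Mon n → ℤ) → List (Mon n) → Set
Annihilates φ L = ∀ a → ∑ L (λ b → φ (a ⊕ b)) ≡ 0ℤ

Standard : ∀ {n} → (ℕ → ℕ) → Mon n → Set
Standard {n} bs m = ∀ k → k < n → m ! k < bs k

standard? : ∀ {n} bs (m : Mon n) → Standard bs m ⊎ Σ ℕ (λ k → k < n × bs k ≤ m ! k)
standard? bs [] = inj₁ (λ k ())
standard? bs (x ∷ m) with x ℕP.<? bs 0 | standard? (bs ∘ suc) m
... | no x≮b | _ = inj₂ (0 , s≤s z≤n , ℕP.≮⇒≥ x≮b)
... | yes _ | inj₂ (k , k<n , b≤m!k) = inj₂ (suc k , s≤s k<n , b≤m!k)
... | yes x<b | inj₁ std = inj₁ λ { zero _ → x<b ; (suc k) (s≤s k<n) → std k k<n }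

record Separating (n : ℕ) (bs : ℕ → ℕ) (o : MonOrder) (m : Mon n) : Set where
  field
    φ : Mon n → ℤ
    annihilates : ∀ k → k < n → Annihilates φ (homMonsFrom n k (bs k))
    at-m : φ m ≡ 1ℤ
    below-m : ∀ a → a <[ o ] m → φ a ≡ 0ℤ

<ᵇ≡false⇒≥ : ∀ {j b} → (j <ᵇ b) ≡ false → b ≤ j
<ᵇ≡false⇒≥ {j} {b} eq = ℕP.≮⇒≥ (λ j<b → subst T eq (ℕP.<⇒<ᵇ j<b))

≡ᵇ-refl : ∀ m → (m ≡ᵇ m) ≡ true
≡ᵇ-refl zero = refl
≡ᵇ-refl (suc m) = ≡ᵇ-refl m

<⇒≡ᵇ≡false : ∀ {j m} → j < m → (j ≡ᵇ m) ≡ false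
<⇒≡ᵇ≡false {zero} {suc m} _ = refl
<⇒≡ᵇ≡false {suc j} {suc m} (s≤s j<m) = <⇒≡ᵇ≡false j<m

-- Extends φ on x₂,…,x_{n+1} to ψ on x₁,…,x_{n+1}.  Below x₁^b, ψ (j ∷ a) is φ a on the
-- slice j = m₁ and 0 elsewhere; from x₁^b on it is forced by annihilating ẽ_b(1,…,n+1) at
-- (j ∸ b) ∷ a, whose t = b term below is ψ (j ∷ a).  The fuel f > j makes the recursion structural.
module Extension {n : ℕ} (b m₁ : ℕ) (φ : Mon n → ℤ) where

  ψ[_] : ℕ → ℕ → Mon n → ℤ
  ψ[ zero ] j a = 0ℤ
  ψ[ suc f ] j a = if j <ᵇ b then (if j ≡ᵇ m₁ then φ a else 0ℤ)
    else - ∑ (upTo b) (λ t → ∑ (homMons n (b ∸ t)) (λ c → ψ[ f ] (j ∸ b ℕ.+ t) (a ⊕ c)))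

  ψ : Mon (suc n) → ℤ
  ψ (j ∷ a) = ψ[ suc j ] j a

  shifted< : ∀ {j t f} → b ≤ j → t < b → j < suc f → j ∸ b ℕ.+ t < f
  shifted< {j} {t} b≤j t<b (s≤s j≤f) =
    ℕP.<-≤-trans (subst (j ∸ b ℕ.+ t <_) (ℕP.m∸n+n≡m b≤j) (ℕP.+-monoʳ-< (j ∸ b) t<b)) j≤f

  fuel-irrelevant : ∀ f g j a → j < f → j < g → ψ[ f ] j a ≡ ψ[ g ] j a
  fuel-irrelevant (suc f) (suc g) j a j<f j<g with j <ᵇ b in eq
  ... | true = refl
  ... | false = cong -_ (∑-cong (upTo b) λ {t} t∈ → ∑-cong (homMons n (b ∸ t)) λ {c} _ →
          fuel-irrelevant f g (j ∸ b ℕ.+ t) (a ⊕ c)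
            (shifted< (<ᵇ≡false⇒≥ eq) (∈-upTo⁻ t∈) j<f) (shifted< (<ᵇ≡false⇒≥ eq) (∈-upTo⁻ t∈) j<g))

  ψ-below : ∀ j a → j < b → ψ (j ∷ a) ≡ (if j ≡ᵇ m₁ then φ a else 0ℤ)
  ψ-below j a j<b with j <ᵇ b in eq
  ... | true = refl
  ... | false = ⊥-elim (ℕP.<⇒≱ j<b (<ᵇ≡false⇒≥ eq))

  ψ-above : ∀ j a → b ≤ j →
    ψ (j ∷ a) ≡ - ∑ (upTo b) (λ t → ∑ (homMons n (b ∸ t)) (λ c → ψ ((j ∸ b ℕ.+ t) ∷ (a ⊕ c))))
  ψ-above j a b≤j with j <ᵇ b in eq
  ... | true = ⊥-elim (ℕP.<⇒≱ (ℕP.<ᵇ⇒< j b (subst T (sym eq) _)) b≤j)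
  ... | false = cong -_ (∑-cong (upTo b) λ {t} t∈ → ∑-cong (homMons n (b ∸ t)) λ {c} _ →
          fuel-irrelevant j (suc (j ∸ b ℕ.+ t)) (j ∸ b ℕ.+ t) (a ⊕ c)
            (shifted< b≤j (∈-upTo⁻ t∈) ℕP.≤-refl) ℕP.≤-refl)

  annihilates-first : Annihilates ψ (homMonsFrom (suc n) 0 b)
  annihilates-first (j ∷ a) = begin
    ∑ (homMonsFrom (suc n) 0 b) (λ x → ψ ((j ∷ a) ⊕ x))
      ≡⟨ cong (λ xs → ∑ xs (λ x → ψ ((j ∷ a) ⊕ x))) (homMonsFrom-zero (suc n) b) ⟩
    ∑ (homMons (suc n) b) (λ x → ψ ((j ∷ a) ⊕ x))
      ≡⟨ ∑-homMons-suc n b (λ x → ψ ((j ∷ a) ⊕ x)) ⟩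
    ∑ (upTo (suc b)) G
      ≡⟨ ∑-upTo-suc b G ⟩
    ∑ (upTo b) G + G b
      ≡⟨ cong (∑ (upTo b) G +_) G[b] ⟩
    ∑ (upTo b) G + ψ ((j ℕ.+ b) ∷ a)
      ≡⟨ cong (∑ (upTo b) G +_) (ψ-above (j ℕ.+ b) a (ℕP.m≤n+m b j)) ⟩
    ∑ (upTo b) G + - ∑ (upTo b) (λ t → ∑ (homMons n (b ∸ t)) (λ c → ψ ((j ℕ.+ b ∸ b ℕ.+ t) ∷ (a ⊕ c))))
      ≡⟨ cong (λ i → ∑ (upTo b) G + - ∑ (upTo b) (λ t → ∑ (homMons n (b ∸ t)) (λ c → ψ ((i ℕ.+ t) ∷ (a ⊕ c)))))
              (ℕP.m+n∸n≡m j b) ⟩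
    ∑ (upTo b) G + - ∑ (upTo b) G
      ≡⟨ ℤP.+-inverseʳ (∑ (upTo b) G) ⟩
    0ℤ ∎
    where
    open ≡-Reasoning
    G : ℕ → ℤ
    G t = ∑ (homMons n (b ∸ t)) (λ c → ψ ((j ℕ.+ t) ∷ (a ⊕ c)))
    G[b] : G b ≡ ψ ((j ℕ.+ b) ∷ a)
    G[b] rewrite ℕP.n∸n≡0 b | homMons-0 n | ⊕-identityʳ a = ℤP.+-identityʳ _

  annihilates-later : ∀ k d → Annihilates φ (homMonsFrom n k d) →
    Annihilates ψ (homMonsFrom (suc n) (suc k) d)
  annihilates-later k d φ-ann (j ∷ a) = begin
    ∑ (homMonsFrom (suc n) (suc k) d) (λ x → ψ ((j ∷ a) ⊕ x))
      ≡⟨ cong (λ xs → ∑ xs (λ x → ψ ((j ∷ a) ⊕ x))) (homMonsFrom-suc n k d) ⟩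
    ∑ (map (0 ∷_) L) (λ x → ψ ((j ∷ a) ⊕ x))
      ≡⟨ ∑-map (0 ∷_) L (λ x → ψ ((j ∷ a) ⊕ x)) ⟩
    ∑ L (λ c → ψ ((j ℕ.+ 0) ∷ (a ⊕ c)))
      ≡⟨ ∑-cong L (λ {c} _ → cong (λ i → ψ (i ∷ (a ⊕ c))) (ℕP.+-identityʳ j)) ⟩
    ∑ L (λ c → ψ (j ∷ (a ⊕ c)))
      ≡⟨ slice (suc j) j ℕP.≤-refl a ⟩
    0ℤ ∎
    where
    open ≡-Reasoning
    L = homMonsFrom n k d
    -- By strong induction on the x₁-exponent j: above b, unfold ψ and swap the sums so
    -- that each summand is a slice sum at a smaller exponent.
    slice : ∀ N j → j < N → ∀ a → ∑ L (λ c → ψ (j ∷ (a ⊕ c))) ≡ 0ℤ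
    slice (suc N) j j<N a with j ℕP.<? b
    ... | yes j<b = trans (∑-cong L (λ {c} _ → ψ-below j (a ⊕ c) j<b)) (bySlice (j ≡ᵇ m₁))
      where
      bySlice : ∀ s → ∑ L (λ c → if s then φ (a ⊕ c) else 0ℤ) ≡ 0ℤ
      bySlice true = φ-ann a
      bySlice false = ∑-zero L (λ _ → refl)
    ... | no j≮b = begin
      ∑ L (λ c → ψ (j ∷ (a ⊕ c)))
        ≡⟨ ∑-cong L (λ {c} _ → ψ-above j (a ⊕ c) b≤j) ⟩
      ∑ L (λ c → - ∑ (upTo b) (λ t → ∑ (H t) (λ c′ → Ψ t c c′)))
        ≡⟨ ∑-neg L (λ c → ∑ (upTo b) (λ t → ∑ (H t) (λ c′ → Ψ t c c′))) ⟩
      - ∑ L (λ c → ∑ (upTo b) (λ t → ∑ (H t) (λ c′ → Ψ t c c′)))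
        ≡⟨ cong -_ (∑-swap L (upTo b) (λ c t → ∑ (H t) (λ c′ → Ψ t c c′))) ⟩
      - ∑ (upTo b) (λ t → ∑ L (λ c → ∑ (H t) (λ c′ → Ψ t c c′)))
        ≡⟨ cong -_ (∑-zero (upTo b) λ {t} t∈ →
             trans (∑-swap L (H t) (Ψ t)) (∑-zero (H t) λ {c′} _ →
               trans (∑-cong L (λ {c} _ → cong (λ x → ψ ((j ∸ b ℕ.+ t) ∷ x)) (⊕-swapʳ a c c′)))
                     (slice N (j ∸ b ℕ.+ t) (shifted< b≤j (∈-upTo⁻ t∈) j<N) (a ⊕ c′)))) ⟩
      - 0ℤ ∎
      where
      b≤j = ℕP.≮⇒≥ j≮b
      H = λ t → homMons n (b ∸ t)
      Ψ = λ t c c′ → ψ ((j ∸ b ℕ.+ t) ∷ ((a ⊕ c) ⊕ c′))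

separating-lex : ∀ n bs (m : Mon n) → Standard bs m → Separating n bs lex m
separating-lex zero bs [] _ =
  record { φ = λ _ → 1ℤ ; annihilates = λ k () ; at-m = refl ; below-m = λ { [] () } }
separating-lex (suc n) bs (m₁ ∷ m) std =
  record { φ = ψ ; annihilates = annihilates ; at-m = at-m ; below-m = below-m }
  where
  S = separating-lex n (bs ∘ suc) m (λ k k<n → std (suc k) (s≤s k<n))
  m₁<b : m₁ < bs 0
  m₁<b = std 0 (s≤s z≤n)
  open Extension (bs 0) m₁ (Separating.φ S)
  annihilates : ∀ k → k < suc n → Annihilates ψ (homMonsFrom (suc n) k (bs k))
  annihilates zero _ = annihilates-first
  annihilates (suc k) (s≤s k<n) = annihilates-later k (bs (suc k)) (Separating.annihilates S k k<n)
  at-m : ψ (m₁ ∷ m) ≡ 1ℤ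
  at-m rewrite ψ-below m₁ m m₁<b | ≡ᵇ-refl m₁ = Separating.at-m S
  below-m : ∀ a → a <lex (m₁ ∷ m) → ψ a ≡ 0ℤ
  below-m (j ∷ a) (inj₁ j<m₁) rewrite ψ-below j a (ℕP.<-trans j<m₁ m₁<b) | <⇒≡ᵇ≡false j<m₁ = refl
  below-m (j ∷ a) (inj₂ (refl , a<m)) rewrite ψ-below j a m₁<b | ≡ᵇ-refl j = Separating.below-m S a a<m

-- The generators are homogeneous, so restricting to the degree of m keeps annihilation.
restrictToDegree : ∀ {n bs} {m : Mon n} → Separating n bs lex m → Separating n bs grlex m
restrictToDegree {n} {bs} {m} S = record
  { φ = φ′ ; annihilates = annihilates ; at-m = at-m ; below-m = below-m }
  where
  open Separating S using (φ)
  φ′ : Mon n → ℤ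
  φ′ a = if deg a ≡ᵇ deg m then φ a else 0ℤ
  annihilates : ∀ k → k < n → Annihilates φ′ (homMonsFrom n k (bs k))
  annihilates k k<n a =
    trans (∑-cong (homMonsFrom n k (bs k)) λ {c} c∈ →
             cong (λ e → if e ≡ᵇ deg m then φ (a ⊕ c) else 0ℤ)
                  (trans (deg-⊕ a c) (cong (deg a ℕ.+_) (All.lookup homMonsFrom-deg c∈))))
          (byDegree (deg a ℕ.+ bs k ≡ᵇ deg m))
    where
    homMonsFrom-deg = AllP.filter⁺ _ (homMons-deg n (bs k))
    byDegree : ∀ s → ∑ (homMonsFrom n k (bs k)) (λ c → if s then φ (a ⊕ c) else 0ℤ) ≡ 0ℤ
    byDegree true = Separating.annihilates S k k<n a
    byDegree false = ∑-zero (homMonsFrom n k (bs k)) (λ _ → refl)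
  at-m : φ′ m ≡ 1ℤ
  at-m rewrite ≡ᵇ-refl (deg m) = Separating.at-m S
  below-m : ∀ a → a <[ grlex ] m → φ′ a ≡ 0ℤ
  below-m a (inj₁ deg<) rewrite <⇒≡ᵇ≡false deg< = refl
  below-m a (inj₂ (deg≡ , a<m)) rewrite deg≡ | ≡ᵇ-refl (deg m) = Separating.below-m S a a<m

separating : ∀ n bs (m : Mon n) o → Standard bs m → Separating n bs o m
separating n bs m lex std = separating-lex n bs m std
separating n bs m grlex std = restrictToDegree (separating-lex n bs m std)

⟪_⟫ : ∀ {n} → (Mon n → ℤ) → Poly n → ℤ
⟪ φ ⟫ F = ∑ F (λ t → proj₁ t * φ (proj₂ t))

⟪⟫-*P-monomials : ∀ {n} φ (q : Poly n) L → Annihilates φ L → ⟪ φ ⟫ (q *P monomials L) ≡ 0ℤ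
⟪⟫-*P-monomials φ [] L ann = refl
⟪⟫-*P-monomials φ ((c , a) ∷ q) L ann =
  trans (∑-++ (shifted L) (q *P monomials L) _)
        (cong₂ _+_ (trans (row L) (trans (cong (c *_) (ann a)) (ℤP.*-zeroʳ c)))
                   (⟪⟫-*P-monomials φ q L ann))
  where
  shifted : List _ → Poly _
  shifted L = map (λ t → (c * proj₁ t , zipWith ℕ._+_ a (proj₂ t))) (monomials L)
  row : ∀ L → ⟪ φ ⟫ (shifted L) ≡ c * ∑ L (λ b → φ (a ⊕ b))
  row [] = sym (ℤP.*-zeroʳ c)
  row (b ∷ L) rewrite row L | ℤP.*-identityʳ c = sym (ℤP.*-distribˡ-+ c (φ (a ⊕ b)) _)

∑-coeffTerm : ∀ {n} (φ : Mon n → ℤ) c m (D : List (Mon n)) → Unique D → m ∈ D →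
  ∑ D (λ a → coeffTerm c m a * φ a) ≡ c * φ m
∑-coeffTerm φ c m (m ∷ D) (m∉D ∷ _) (here refl) = begin
  coeffTerm c m m * φ m + ∑ D (λ a → coeffTerm c m a * φ a)
    ≡⟨ cong₂ (λ x y → x * φ m + y) (coeffTerm-≡ c m)
             (∑-zero D λ a∈D → cong (_* φ _) (coeffTerm-≢ c (All.lookup m∉D a∈D))) ⟩
  c * φ m + 0ℤ
    ≡⟨ ℤP.+-identityʳ _ ⟩
  c * φ m ∎
  where open ≡-Reasoning
∑-coeffTerm φ c m (a ∷ D) (a∉D ∷ uniq) (there m∈D) with m ≟ᵐ a
... | yes refl = ⊥-elim (All.lookup a∉D m∈D refl)
... | no _ = trans (ℤP.+-identityˡ _) (∑-coeffTerm φ c m D uniq m∈D)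

⟪⟫-by-coeff : ∀ {n} φ (F : Poly n) (D : List (Mon n)) → Unique D → All (λ t → proj₂ t ∈ D) F →
  ⟪ φ ⟫ F ≡ ∑ D (λ a → coeff F a * φ a)
⟪⟫-by-coeff φ [] D _ [] = sym (∑-zero D (λ _ → refl))
⟪⟫-by-coeff φ ((c , m) ∷ F) D uniq (m∈D ∷ F⊆D) = begin
  c * φ m + ⟪ φ ⟫ F
    ≡⟨ cong₂ _+_ (sym (∑-coeffTerm φ c m D uniq m∈D)) (⟪⟫-by-coeff φ F D uniq F⊆D) ⟩
  ∑ D (λ a → coeffTerm c m a * φ a) + ∑ D (λ a → coeff F a * φ a)
    ≡⟨ sym (∑-+ D _ _) ⟩
  ∑ D (λ a → coeffTerm c m a * φ a + coeff F a * φ a)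
    ≡⟨ ∑-cong D (λ {a} _ → trans (sym (ℤP.*-distribʳ-+ (φ a) (coeffTerm c m a) (coeff F a)))
                                 (cong (_* φ a) (sym (coeff-∷ c m F a)))) ⟩
  ∑ D (λ a → coeff ((c , m) ∷ F) a * φ a) ∎
  where open ≡-Reasoning

-- Distinct terms of F may share, and cancel on, a monomial, so the sum is regrouped
-- over the deduplicated support before φ is used.
⟪⟫-concentrated : ∀ {n} φ (F : Poly n) m → coeff F m ≢ 0ℤ →
  (∀ a → coeff F a ≢ 0ℤ → a ≢ m → φ a ≡ 0ℤ) → ⟪ φ ⟫ F ≡ coeff F m * φ m
⟪⟫-concentrated φ F m F[m]≢0 kernel = begin
  ⟪ φ ⟫ F
    ≡⟨ ⟪⟫-by-coeff φ F D uniq (All.tabulate (λ t∈F → ∈-deduplicate⁺ _≟ᵐ_ (∈-map⁺ proj₂ t∈F))) ⟩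
  ∑ D (λ a → coeff F a * φ a)
    ≡⟨ ∑-cong D (λ {a} _ → concentrate a) ⟩
  ∑ D (λ a → coeffTerm (coeff F m) m a * φ a)
    ≡⟨ ∑-coeffTerm φ (coeff F m) m D uniq (∈-deduplicate⁺ _≟ᵐ_ (coeff≢0⇒∈ F m F[m]≢0)) ⟩
  coeff F m * φ m ∎
  where
  open ≡-Reasoning
  D = deduplicate _≟ᵐ_ (map proj₂ F)
  uniq = deduplicate-! _≟ᵐ_ (map proj₂ F)
  concentrate : ∀ a → coeff F a * φ a ≡ coeffTerm (coeff F m) m a * φ a
  concentrate a with m ≟ᵐ a
  ... | yes refl = refl
  ... | no m≢a with coeff F a ℤ.≟ 0ℤ
  ...   | yes F[a]≡0 rewrite F[a]≡0 = refl
  ...   | no F[a]≢0 rewrite kernel a F[a]≢0 (m≢a ∘ sym) = ℤP.*-zeroʳ (coeff F a)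

∈⇒InIdeal : ∀ {n} {G : List (Poly n)} {g} → g ∈ G → InIdeal (_∈ G) g
∈⇒InIdeal {g = g} g∈G = [ ([ (1ℤ , zeros) ] , g) ] , g∈G ∷ [] ,
  λ m → cong (λ F → coeff F m) (sym (trans (++-identityʳ _) (trans (++-identityʳ _) (one* g))))
  where
  one* : ∀ {n} (F : Poly n) → map (λ t → (1ℤ * proj₁ t , zipWith ℕ._+_ zeros (proj₂ t))) F ≡ F
  one* [] = refl
  one* ((c , a) ∷ F) = cong₂ _∷_ (cong₂ _,_ (ℤP.*-identityˡ c) (⊕-identityˡ a)) (one* F)

InIdeal-⊆ : ∀ {n} {S T : Poly n → Set} → (∀ {g} → S g → T g) → ∀ {p} → InIdeal S p → InIdeal T p
InIdeal-⊆ S⊆T (qs , S[qs] , p≈) = qs , All.map S⊆T S[qs] , p≈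

-- Quantified over the multiplier q because *P is associative only up to ≈P; in this form
-- a combination Σ qᵢ gᵢ is rewritten term by term up to ≡.
Factors : ∀ {n} → (Poly n → Set) → Poly n → Set
Factors {n} T g = Σ (Poly n) λ r → Σ (Poly n) λ t → T t × (∀ q → q *P g ≡ (q *P r) *P t)

InIdeal-factor : ∀ {n} {S T : Poly n → Set} → (∀ {g} → S g → Factors T g) →
  ∀ {p} → InIdeal S p → InIdeal T p
InIdeal-factor {n} {S} {T} factor (qs , S[qs] , p≈) with refactor qs S[qs]
  where
  refactor : ∀ qs → All (S ∘ proj₂) qs →
    Σ (List (Poly n × Poly n)) λ qs′ → All (T ∘ proj₂) qs′ × combo qs ≡ combo qs′
  refactor [] [] = [] , [] , refl
  refactor ((q , g) ∷ qs) (Sg ∷ S[qs]) with factor Sg | refactor qs S[qs]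
  ... | r , t , Tt , g≡rt | qs′ , T[qs′] , qs≡qs′ =
    (q *P r , t) ∷ qs′ , Tt ∷ T[qs′] , cong₂ _++_ (g≡rt q) qs≡qs′
... | qs′ , T[qs′] , qs≡qs′ = qs′ , T[qs′] , λ m → trans (p≈ m) (cong (λ F → coeff F m) qs≡qs′)

*P-term-⊕ : ∀ {n} (q : Poly n) c {m m′ u} → m′ ⊕ u ≡ m →
  q *P [ (c , m) ] ≡ (q *P [ (c , m′) ]) *P [ (1ℤ , u) ]
*P-term-⊕ [] c e = refl
*P-term-⊕ ((d , a) ∷ q) c {m′ = m′} {u} e =
  cong₂ _∷_ (cong₂ _,_ (sym (ℤP.*-identityʳ (d * c))) (trans (cong (a ⊕_) (sym e)) (sym (⊕-assoc a m′ u))))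
            (*P-term-⊕ q c e)

ẽs : (n : ℕ) → (ℕ → ℕ) → List (Poly n)
ẽs n d = map (λ i → ẽ n (d i) i) (oneTo n)

∈-ẽs⁺ : ∀ {n} d {k} → k < n → ẽ n (d (suc k)) (suc k) ∈ ẽs n d
∈-ẽs⁺ d k<n = ∈-map⁺ _ (∈-map⁺ suc (∈-upTo⁺ k<n))

∈-ẽs⁻ : ∀ {n} d {g} → g ∈ ẽs n d → Σ ℕ λ k → k < n × g ≡ monomials (homMonsFrom n k (d (suc k)))
∈-ẽs⁻ d g∈ with ∈-map⁻ _ g∈
... | i , i∈ , refl with ∈-map⁻ suc i∈
... | k , k∈ , refl = k , ∈-upTo⁻ k∈ , refl

leadingMon-nonstandard : ∀ n d o {f c m} → InIdeal (_∈ ẽs n d) f → IsLT o f [ (c , m) ] →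
  ¬ Standard (d ∘ suc) m
leadingMon-nonstandard n d o {f} {c} {m} (qs , gs∈ , f≈) (_ , _ , c≢0 , f[m]≡c , maximal , refl) std =
  c≢0 (begin
    c                                  ≡⟨ sym (ℤP.*-identityʳ c) ⟩
    c * 1ℤ                             ≡⟨ sym (cong₂ _*_ F[m]≡c at-m) ⟩
    coeff F m * φ m                    ≡⟨ sym (⟪⟫-concentrated φ F m F[m]≢0 kernel) ⟩
    ⟪ φ ⟫ F                            ≡⟨ vanishes qs gs∈ ⟩
    0ℤ                                 ∎)
  where
  open ≡-Reasoning
  open Separating (separating n (d ∘ suc) m o std)
  F = combo qs
  F[m]≡c : coeff F m ≡ c
  F[m]≡c = trans (sym (f≈ m)) f[m]≡c
  F[m]≢0 : coeff F m ≢ 0ℤ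
  F[m]≢0 F[m]≡0 = c≢0 (trans (sym F[m]≡c) F[m]≡0)
  kernel : ∀ a → coeff F a ≢ 0ℤ → a ≢ m → φ a ≡ 0ℤ
  kernel a F[a]≢0 a≢m with maximal a (F[a]≢0 ∘ trans (sym (f≈ a)))
  ... | inj₁ a<m = below-m a a<m
  ... | inj₂ a≡m = ⊥-elim (a≢m a≡m)
  vanishes : ∀ qs → All (λ qg → proj₂ qg ∈ ẽs n d) qs → ⟪ φ ⟫ (combo qs) ≡ 0ℤ
  vanishes [] [] = refl
  vanishes ((q , g) ∷ qs) (g∈ ∷ gs∈) with ∈-ẽs⁻ d g∈
  ... | k , k<n , refl = trans (∑-++ (q *P g) (combo qs) _)
    (cong₂ _+_ (⟪⟫-*P-monomials φ q _ (annihilates k k<n)) (vanishes qs gs∈))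

leadingTerm-factors : ∀ n d o {t} → LTs o (InIdeal (_∈ ẽs n d)) t → Factors (LTs o (_∈ ẽs n d)) t
leadingTerm-factors n d o (f , f∈J , lt@(c , m , _ , _ , _ , refl)) with standard? (d ∘ suc) m
... | inj₁ std = ⊥-elim (leadingMon-nonstandard n d o {f} f∈J lt std)
... | inj₂ (k , k<n , d≤m!k) =
  [ (c , m ∸ᵐ u) ] , [ (1ℤ , u) ] ,
  (ẽ n (d (suc k)) (suc k) , ∈-ẽs⁺ d k<n , ẽ-leadingTerm n k (d (suc k)) o k<n) ,
  (λ q → *P-term-⊕ q c (∸ᵐ-xPow n k (d (suc k)) m k<n d≤m!k))
  where u = xPow n k (d (suc k))

ẽs-groebner : ∀ n d o → IsGroebnerBasisOf o (ẽs n d) (InIdeal (_∈ ẽs n d))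
ẽs-groebner n d o p = mk⇔
  (InIdeal-factor (leadingTerm-factors n d o) {p})
  (InIdeal-⊆ (λ { (f , f∈G , lt) → f , ∈⇒InIdeal f∈G , lt }) {p})

theorem5p7 : (n : ℕ) (h : ℕ → ℕ) → IsHessenberg n h →
  (o : MonOrder) → IsGroebnerBasisOf o (𝒥 n h) (J n h)
theorem5p7 n h _ = ẽs-groebner n (β n h)
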